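{- For every finite simple graph $G$, \[\gamma_{cy}(G)\leq i_{cy}(G)\leq\beta_{cy}(G)\leq\Gamma_{cy}(G).\]
   Context: For $S\subseteq V$, $\langle S\rangle$ is the induced subgraph; maximal/minimal are with respect to inclusion. $S$ is cycle independent if $\langle S\rangle$ is acyclic; $\beta_{cy}(G)$ is the maximum size of a cycle independent set and $i_{cy}(G)$ the minimum size of a maximal one. $S$ is cycle dominating if for every $u\in V\setminus S$ there is a cycle in $\langle S\cup\{u\}\rangle$ containing $u$; $\gamma_{cy}(G)$ is the minimum size of a cycle dominating set and $\Gamma_{cy}(G)$ the maximum size of a minimal one. -}

module Defs where

open import Data.Nat using (ℕ; _≤_)
open import Data.Empty using (⊥)
open import Data.Bool using (Bool; T)
open import Data.Fin using (Fin)
open import Data.Fin.Subset using (Subset; _∈_; _∉_; _⊆_; _∪_; ⁅_⁆; ∣_∣)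
open import Data.List using (List; []; _∷_; length)
open import Data.List.Relation.Unary.All using (All)
open import Data.List.Relation.Unary.Unique.Propositional using (Unique)
import Data.List.Membership.Propositional as LM
open import Data.Product using (Σ; _×_)
open import Relation.Nullary using (¬_)
open import Relation.Binary.PropositionalEquality using (_≡_)

record Graph (n : ℕ) : Set where
  field
    adj    : Fin n → Fin n → Bool
    sym    : ∀ x y → adj x y ≡ adj y x
    irrefl : ∀ x → T (adj x x) → ⊥
  Adj : Fin n → Fin n → Set
  Adj x y = T (adj x y)
open Graph public

module _ {n : ℕ} (G : Graph n) where

  Walk : Fin n → List (Fin n) → Fin n → Set
  Walk a []       b = Adj G a b
  Walk a (y ∷ ys) b = Adj G a y × Walk y ys b

  -- Cycle x xs : the vertex sequence x, xs₁, …, xsₖ (k ≥ 2, all distinct)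
  -- forms a cycle x – xs₁ – … – xsₖ – x of length k+1 ≥ 3.
  Cycle : Fin n → List (Fin n) → Set
  Cycle x xs = (2 ≤ length xs) × Unique (x ∷ xs) × Walk x xs x

  CycleIn : Subset n → Fin n → List (Fin n) → Set
  CycleIn S x xs = Cycle x xs × All (_∈ S) (x ∷ xs)

  CycleIndependent : Subset n → Set
  CycleIndependent S = ¬ (Σ (Fin n) λ x → Σ (List (Fin n)) λ xs → CycleIn S x xs)

  CycleDominating : Subset n → Set
  CycleDominating S = ∀ u → u ∉ S →
    Σ (Fin n) λ x → Σ (List (Fin n)) λ xs →
      CycleIn (S ∪ ⁅ u ⁆) x xs × LM._∈_ u (x ∷ xs)

  MaximalCycleIndependent : Subset n → Set
  MaximalCycleIndependent S =
    CycleIndependent S × (∀ T → S ⊆ T → CycleIndependent T → T ⊆ S)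

  MinimalCycleDominating : Subset n → Set
  MinimalCycleDominating S =
    CycleDominating S × (∀ T → T ⊆ S → CycleDominating T → S ⊆ T)

IsMinimum : {n : ℕ} → (Subset n → Set) → ℕ → Set
IsMinimum {n} P k =
  (Σ (Subset n) λ S → P S × ∣ S ∣ ≡ k) × (∀ S → P S → k ≤ ∣ S ∣)

IsMaximum : {n : ℕ} → (Subset n → Set) → ℕ → Set
IsMaximum {n} P k =
  (Σ (Subset n) λ S → P S × ∣ S ∣ ≡ k) × (∀ S → P S → ∣ S ∣ ≤ k)

-- A maximum cycle independent set S is inclusion-maximal. Every u ∉ S then
-- closes a cycle in ⟨S ∪ {u}⟩, necessarily through u since ⟨S⟩ is acyclic, so
-- every maximal cycle independent set is cycle dominating; it is even minimal,
-- because dropping x ∈ S leaves a set T for which ⟨T ∪ {x}⟩ ⊆ ⟨S⟩ has no cycle.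
-- Hence γ_cy ≤ i_cy (maximal independent sets dominate), i_cy ≤ β_cy (maximum
-- sets are maximal) and β_cy ≤ Γ_cy (maximum sets are minimal dominating).
-- Constructively, the four extremal sizes exist because all the properties are
-- decidable: cycles have fewer than n vertices, so a bounded search finds them.
module Submission where

open import Defs
open import Data.Nat using (ℕ; zero; suc; _≤_; _<_; _∸_; z≤n; s≤s; _≤?_; _<?_)
open import Data.Nat.Properties using (<⇒≤; ≮⇒≥; <⇒≱; ∸-monoʳ-<)
open import Data.Nat.Induction using (<-wellFounded)
open import Induction.WellFounded using (Acc; acc)
open import Data.Product using (Σ; _×_; ∃; ∃-syntax; _,_; proj₁; proj₂)
open import Data.Sum using (inj₁; inj₂)
open import Data.Empty using (⊥-elim)
open import Data.Fin using (Fin; zero; suc)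
import Data.Fin.Properties as Fin
open import Data.Fin.Subset using (Subset; _∈_; _⊆_; _∪_; ⁅_⁆; ∣_∣) renaming (⊥ to ∅)
open import Data.Fin.Subset.Properties
  using (_∈?_; _⊆?_; anySubset?; ∉⊥; x∈p∪q⁻; x∈p∪q⁺; x∈⁅x⁆; x∈⁅y⁆⇒x≡y; p⊂q⇒∣p∣<∣q∣; ∣p∣≤n)
open import Data.List using (List; []; _∷_; length; lookup)
open import Data.List.Relation.Unary.All as All using (All; []; _∷_)
open import Data.List.Relation.Unary.Any using (here; there; any?)
open import Data.List.Relation.Unary.AllPairs using (_∷_)
open import Data.List.Relation.Unary.Unique.Propositional using (Unique)
import Data.List.Relation.Unary.Unique.DecPropositional as Unique
open import Data.List.Membership.Propositional using () renaming (_∉_ to _∉ₗ_)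
open import Data.List.Membership.Propositional.Properties using (∈-lookup)
open import Relation.Unary using (Decidable)
open import Relation.Nullary using (Dec; yes; no)
open import Relation.Nullary.Decidable using (_×-dec_; _→-dec_; ¬?; decidable-stable; T?)
open import Relation.Binary.PropositionalEquality using (_≡_; refl; subst) renaming (sym to ≡-sym)

module _ {n : ℕ} where

  allSubset? : {P : Subset n → Set} → Decidable P → Dec (∀ S → P S)
  allSubset? P? with anySubset? (λ S → ¬? (P? S))
  ... | yes (S , ¬pS) = no λ ∀p → ¬pS (∀p S)
  ... | no ∄¬p        = yes λ S → decidable-stable (P? S) λ ¬pS → ∄¬p (S , ¬pS)

  module _ {P : Subset n → Set} (P? : Decidable P) where

    minimum-exists : ∃ P → ∃ (IsMinimum P)
    minimum-exists (S , pS) = descend S pS (<-wellFounded ∣ S ∣)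
      where
      descend : ∀ S → P S → Acc _<_ ∣ S ∣ → ∃ (IsMinimum P)
      descend S pS (acc smaller) with anySubset? (λ T → P? T ×-dec (∣ T ∣ <? ∣ S ∣))
      ... | yes (T , pT , ∣T∣<∣S∣) = descend T pT (smaller ∣T∣<∣S∣)
      ... | no ∄smaller = ∣ S ∣ , (S , pS , refl) , λ T pT → ≮⇒≥ λ lt → ∄smaller (T , pT , lt)

    maximum-exists : ∃ P → ∃ (IsMaximum P)
    maximum-exists (S , pS) = ascend S pS (<-wellFounded (n ∸ ∣ S ∣))
      where
      ascend : ∀ S → P S → Acc _<_ (n ∸ ∣ S ∣) → ∃ (IsMaximum P)
      ascend S pS (acc smaller) with anySubset? (λ T → P? T ×-dec (∣ S ∣ <? ∣ T ∣))
      ... | yes (T , pT , ∣S∣<∣T∣) = ascend T pT (smaller (∸-monoʳ-< ∣S∣<∣T∣ (∣p∣≤n T)))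
      ... | no ∄larger = ∣ S ∣ , (S , pS , refl) , λ T pT → ≮⇒≥ λ lt → ∄larger (T , pT , lt)

  largest⇒maximal : {P : Subset n → Set} {S : Subset n} {k : ℕ} →
                    (∀ T → P T → ∣ T ∣ ≤ k) → ∣ S ∣ ≡ k → ∀ T → S ⊆ T → P T → T ⊆ S
  largest⇒maximal {S = S} largest refl T S⊆T pT {x} x∈T with x ∈? S
  ... | yes x∈S = x∈S
  ... | no  x∉S = ⊥-elim (<⇒≱ (p⊂q⇒∣p∣<∣q∣ (S⊆T , x , x∈T , x∉S)) (largest T pT))

  lookup-injective : {xs : List (Fin n)} → Unique xs → ∀ i j → lookup xs i ≡ lookup xs j → i ≡ j
  lookup-injective (_ ∷ _)       zero    zero    _  = refl
  lookup-injective (x∉xs ∷ _)    zero    (suc j) eq = ⊥-elim (All.lookup x∉xs (∈-lookup j) eq)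
  lookup-injective (x∉xs ∷ _)    (suc i) zero    eq = ⊥-elim (All.lookup x∉xs (∈-lookup i) (≡-sym eq))
  lookup-injective (_ ∷ unique)  (suc i) (suc j) eq with refl ← lookup-injective unique i j eq = refl

  length≤-unique : {xs : List (Fin n)} → Unique xs → length xs ≤ n
  length≤-unique unique = Fin.injective⇒≤ (λ {i} {j} → lookup-injective unique i j)

  anyList≤? : ∀ m {P : List (Fin n) → Set} → Decidable P → Dec (∃ λ xs → length xs ≤ m × P xs)
  anyList≤? m P? with P? []
  anyList≤? m       P? | yes p[] = yes ([] , z≤n , p[])
  anyList≤? zero    P? | no ¬p[] = no λ { ([] , _ , p[]) → ¬p[] p[] }
  anyList≤? (suc m) P? | no ¬p[] with Fin.any? (λ y → anyList≤? m (λ ys → P? (y ∷ ys)))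
  ... | yes (y , ys , len≤ , p) = yes (y ∷ ys , s≤s len≤ , p)
  ... | no ∄cons = no λ { ([] , _ , p[]) → ¬p[] p[]
                         ; (y ∷ ys , s≤s len≤ , p) → ∄cons (y , ys , len≤ , p) }

  anyList? : ∀ {m} {P : List (Fin n) → Set} → Decidable P → (∀ {xs} → P xs → length xs ≤ m) →
             Dec (∃ P)
  anyList? {m} P? bounded with anyList≤? m P?
  ... | yes (xs , _ , p) = yes (xs , p)
  ... | no ∄short        = no λ (xs , p) → ∄short (xs , bounded p , p)

  All-∈-∪⁅⁆⁻ : ∀ {S u} {xs : List (Fin n)} → All (_∈ S ∪ ⁅ u ⁆) xs → u ∉ₗ xs → All (_∈ S) xs
  All-∈-∪⁅⁆⁻ [] _ = []
  All-∈-∪⁅⁆⁻ {S} {u} (y∈S∪u ∷ rest) u∉ with x∈p∪q⁻ S ⁅ u ⁆ y∈S∪u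
  ... | inj₁ y∈S = y∈S ∷ All-∈-∪⁅⁆⁻ rest (λ u∈ → u∉ (there u∈))
  ... | inj₂ y∈u = ⊥-elim (u∉ (here (≡-sym (x∈⁅y⁆⇒x≡y u y∈u))))

  ∪⁅⁆-⊆ : ∀ {S T : Subset n} {x} → T ⊆ S → x ∈ S → T ∪ ⁅ x ⁆ ⊆ S
  ∪⁅⁆-⊆ {T = T} {x} T⊆S x∈S {y} y∈ with x∈p∪q⁻ T ⁅ x ⁆ y∈
  ... | inj₁ y∈T = T⊆S y∈T
  ... | inj₂ y∈x = subst (_∈ _) (≡-sym (x∈⁅y⁆⇒x≡y x y∈x)) x∈S

module _ {n : ℕ} (G : Graph n) where

  walk? : ∀ a xs b → Dec (Walk G a xs b)
  walk? a []       b = T? (adj G a b)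
  walk? a (y ∷ ys) b = T? (adj G a y) ×-dec walk? y ys b

  cycle? : ∀ x xs → Dec (Cycle G x xs)
  cycle? x xs = (2 ≤? length xs) ×-dec Unique.unique? Fin._≟_ (x ∷ xs) ×-dec walk? x xs x

  cycleIn? : ∀ S x xs → Dec (CycleIn G S x xs)
  cycleIn? S x xs = cycle? x xs ×-dec All.all? (_∈? S) (x ∷ xs)

  cycle-length≤ : ∀ {x xs} → Cycle G x xs → length xs ≤ n
  cycle-length≤ (_ , unique , _) = <⇒≤ (length≤-unique unique)

  anyCycle? : {P : Fin n → List (Fin n) → Set} → (∀ x xs → Dec (P x xs)) →
              (∀ {x xs} → P x xs → Cycle G x xs) → Dec (∃[ x ] ∃[ xs ] P x xs)
  anyCycle? P? P⇒cycle = Fin.any? λ x → anyList? (P? x) (λ p → cycle-length≤ (P⇒cycle p))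

  cycleIndependent? : Decidable (CycleIndependent G)
  cycleIndependent? S = ¬? (anyCycle? (cycleIn? S) proj₁)

  cycleDominating? : Decidable (CycleDominating G)
  cycleDominating? S = Fin.all? λ u → ¬? (u ∈? S) →-dec
    anyCycle? (λ x xs → cycleIn? (S ∪ ⁅ u ⁆) x xs ×-dec any? (u Fin.≟_) (x ∷ xs))
              (λ p → proj₁ (proj₁ p))

  maximalCycleIndependent? : Decidable (MaximalCycleIndependent G)
  maximalCycleIndependent? S = cycleIndependent? S ×-dec
    allSubset? (λ T → S ⊆? T →-dec (cycleIndependent? T →-dec T ⊆? S))

  minimalCycleDominating? : Decidable (MinimalCycleDominating G)
  minimalCycleDominating? S = cycleDominating? S ×-dec
    allSubset? (λ T → T ⊆? S →-dec (cycleDominating? T →-dec S ⊆? T))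

  cycleIndependent-∅ : CycleIndependent G ∅
  cycleIndependent-∅ (_ , _ , _ , x∈∅ ∷ _) = ∉⊥ x∈∅

  cycleIndependent-antitone : ∀ {S T} → T ⊆ S → CycleIndependent G S → CycleIndependent G T
  cycleIndependent-antitone T⊆S indepS (x , xs , cycle , inT) =
    indepS (x , xs , cycle , All.map T⊆S inT)

  maximum⇒maximal : ∀ {k} → IsMaximum (CycleIndependent G) k →
                    ∃ λ S → MaximalCycleIndependent G S × ∣ S ∣ ≡ k
  maximum⇒maximal ((S , indep , ∣S∣≡k) , largest) =
    S , (indep , largest⇒maximal largest ∣S∣≡k) , ∣S∣≡k

  maximal⇒dominating : ∀ {S} → MaximalCycleIndependent G S → CycleDominating G S
  maximal⇒dominating {S} (indep , maximal) u u∉S with anyCycle? (cycleIn? (S ∪ ⁅ u ⁆)) proj₁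
  ... | no acyclic = ⊥-elim (u∉S (maximal (S ∪ ⁅ u ⁆) (λ x∈S → x∈p∪q⁺ (inj₁ x∈S)) acyclic
                                          (x∈p∪q⁺ (inj₂ (x∈⁅x⁆ u)))))
  ... | yes (x , xs , cycle , inS∪u) with any? (u Fin.≟_) (x ∷ xs)
  ...   | yes u∈cycle = x , xs , (cycle , inS∪u) , u∈cycle
  ...   | no  u∉cycle = ⊥-elim (indep (x , xs , cycle , All-∈-∪⁅⁆⁻ inS∪u u∉cycle))

  maximal⇒minimalDominating : ∀ {S} → MaximalCycleIndependent G S → MinimalCycleDominating G S
  maximal⇒minimalDominating {S} maximal@(indep , _) = maximal⇒dominating maximal , minimal
    where
    minimal : ∀ T → T ⊆ S → CycleDominating G T → S ⊆ T
    minimal T T⊆S dominating {x} x∈S with x ∈? T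
    ... | yes x∈T = x∈T
    ... | no  x∉T with (y , ys , cycleIn , _) ← dominating x x∉T =
      ⊥-elim (cycleIndependent-antitone (∪⁅⁆-⊆ T⊆S x∈S) indep (y , ys , cycleIn))

mainTheorem11 : (n : ℕ) (G : Graph n) →
    Σ ℕ λ γcy → Σ ℕ λ icy → Σ ℕ λ βcy → Σ ℕ λ Γcy →
    IsMinimum (CycleDominating G) γcy
    × IsMinimum (MaximalCycleIndependent G) icy
    × IsMaximum (CycleIndependent G) βcy
    × IsMaximum (MinimalCycleDominating G) Γcy
    × γcy ≤ icy × icy ≤ βcy × βcy ≤ Γcy
mainTheorem11 n G
  with β , β-max ← maximum-exists (cycleIndependent? G) (∅ , cycleIndependent-∅ G)
  with S , maximal , ∣S∣≡β ← maximum⇒maximal G β-max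
  with γ , γ-min ← minimum-exists (cycleDominating? G) (S , maximal⇒dominating G maximal)
  with i , i-min@((Sᵢ , maximalᵢ , ∣Sᵢ∣≡i) , _)
         ← minimum-exists (maximalCycleIndependent? G) (S , maximal)
  with Γ , Γ-max ← maximum-exists (minimalCycleDominating? G) (S , maximal⇒minimalDominating G maximal)
  = γ , i , β , Γ , γ-min , i-min , β-max , Γ-max
  , subst (γ ≤_) ∣Sᵢ∣≡i (proj₂ γ-min Sᵢ (maximal⇒dominating G maximalᵢ))
  , subst (i ≤_) ∣S∣≡β (proj₂ i-min S maximal)
  , subst (_≤ Γ) ∣S∣≡β (proj₂ Γ-max S (maximal⇒minimalDominating G maximal))
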